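{- For every permutation $\pi$ (as in the context), $d'(\pi)\ge\left\lfloor\frac{b(\pi)}{2}\right\rfloor$.
   Context: A permutation is $\pi=[\pi_0,\pi_1,\ldots,\pi_n,\pi_{n+1}]$ with $\pi_0=0$, $\pi_{n+1}=n+1$ and $(\pi_1,\ldots,\pi_n)$ a permutation of $\{1,\ldots,n\}$. A prefix reversal $\beta(1,j)$, $3\le j\le n+1$, gives $[\pi_0,\pi_{j-1},\ldots,\pi_1,\pi_j,\ldots,\pi_{n+1}]$. A prefix transposition $\tau(1,j,k)$, $2\le j\le n$, $j<k\le n+1$, gives $[\pi_0,\pi_j,\ldots,\pi_{k-1},\pi_1,\ldots,\pi_{j-1},\pi_k,\ldots,\pi_{n+1}]$. A prefix transreversal $\beta\tau(1,j,k)$, same ranges, gives $[\pi_0,\pi_j,\ldots,\pi_{k-1},\pi_{j-1},\ldots,\pi_1,\pi_k,\ldots,\pi_{n+1}]$. The identity has $\pi_i=i$ for all $i$. $d'(\pi)$ is the minimum number of operations (prefix reversals, prefix transpositions, prefix transreversals) transforming $\pi$ into the identity. Breakpoints: position $1$ is always a breakpoint; for $2\le i\le n+1$, position $i$ is a breakpoint iff $|\pi_i-\pi_{i-1}|\neq 1$. $b(\pi)$ is the number of breakpoints. -}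

module Defs where

open import Data.Nat.Base using (ℕ; zero; suc; _+_; _∸_; _≤_; _<_; ∣_-_∣; ⌊_/2⌋)
open import Data.Nat.Properties using (_≟_)
open import Data.List.Base using (List; []; _∷_; _++_; [_]; length; map; upTo; take; drop; reverse)
open import Relation.Nullary.Decidable using (yes; no)

-- A permutation π = [0, π₁, …, πₙ, n+1] is represented by the list
-- (π₁ ∷ … ∷ πₙ ∷ []) of its inner entries; π₀ = 0 and πₙ₊₁ = n+1 are implicit.
-- n = length of the list.

identity : ℕ → List ℕ
identity n = map suc (upTo n)

isBreak : ℕ → ℕ → ℕ
isBreak x y with ∣ y - x ∣ ≟ 1
... | yes _ = 0
... | no  _ = 1

adjBreaks : List ℕ → ℕ
adjBreaks []           = 0
adjBreaks (x ∷ [])     = 0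
adjBreaks (x ∷ y ∷ ys) = isBreak x y + adjBreaks (y ∷ ys)

-- b(π): position 1 is always a breakpoint; for 2 ≤ i ≤ n+1, position i is a
-- breakpoint iff |π_i - π_{i-1}| ≠ 1.  The pairs (π_{i-1}, π_i), 2 ≤ i ≤ n+1,
-- are exactly the consecutive pairs of  π₁, …, πₙ, n+1.
breakpoints : List ℕ → ℕ
breakpoints π = suc (adjBreaks (π ++ [ suc (length π) ]))

-- One operation (positions are 1-based as in the paper, n = length xs).
data Step (xs : List ℕ) : List ℕ → Set where
  prefixReversal : (j : ℕ) → 3 ≤ j → j ≤ suc (length xs) →
    Step xs (reverse (take (j ∸ 1) xs) ++ drop (j ∸ 1) xs)
  prefixTransposition : (j k : ℕ) → 2 ≤ j → j ≤ length xs → j < k → k ≤ suc (length xs) →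
    Step xs (take (k ∸ j) (drop (j ∸ 1) xs) ++ take (j ∸ 1) xs ++ drop (k ∸ 1) xs)
  prefixTransreversal : (j k : ℕ) → 2 ≤ j → j ≤ length xs → j < k → k ≤ suc (length xs) →
    Step xs (take (k ∸ j) (drop (j ∸ 1) xs) ++ reverse (take (j ∸ 1) xs) ++ drop (k ∸ 1) xs)

data Steps : List ℕ → ℕ → List ℕ → Set where
  done : ∀ {xs} → Steps xs 0 xs
  step : ∀ {xs ys zs m} → Step xs ys → Steps ys m zs → Steps xs (suc m) zs

-- An operation moves a prefix block A, possibly reversed, behind a block B.
-- Reversal preserves the breakpoints inside A, and besides the always-counted
-- position 1 only the two junctions A|B and B|rest are destroyed, so each
-- operation removes at most two breakpoints.  The identity has exactly one,
-- whence b(π) ≤ 2m + 1.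
module Submission where

open import Defs
open import Data.Nat.Base using (ℕ; zero; suc; _+_; _∸_; _≤_; ∣_-_∣; ⌊_/2⌋; ⌈_/2⌉; z≤n; s≤s)
open import Data.Nat.Properties
open import Algebra.Properties.CommutativeSemigroup +-commutativeSemigroup using (x∙yz≈y∙xz)
open import Data.List.Base using (List; []; _∷_; _++_; [_]; _∷ʳ_; length; upTo; applyUpTo; take; drop; reverse)
open import Data.List.Properties
  using (++-assoc; ++-identityʳ; length-++; length-map; length-reverse; length-upTo;
         unfold-reverse; take++drop≡id; drop-drop; map-upTo; applyUpTo-∷ʳ)
open import Data.List.Relation.Binary.Permutation.Propositional using (_↭_)
open import Relation.Binary.PropositionalEquality using (_≡_; refl; sym; trans; cong; cong₂; subst; module ≡-Reasoning)
open import Function.Base using (_∘_)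
open import Relation.Nullary.Decidable using (yes; no)
open import Relation.Nullary.Negation using (contradiction)

isBreak-sym : ∀ x y → isBreak x y ≡ isBreak y x
isBreak-sym x y with ∣ y - x ∣ ≟ 1 | ∣ x - y ∣ ≟ 1
... | yes _   | yes _   = refl
... | no _    | no _    = refl
... | yes ≡1  | no ≢1   = contradiction (trans (∣-∣-comm x y) ≡1) ≢1
... | no ≢1   | yes ≡1  = contradiction (trans (∣-∣-comm y x) ≡1) ≢1

isBreak≤1 : ∀ x y → isBreak x y ≤ 1
isBreak≤1 x y with ∣ y - x ∣ ≟ 1
... | yes _ = z≤n
... | no _  = s≤s z≤n

isBreak-suc : ∀ x → isBreak x (suc x) ≡ 0
isBreak-suc x with ∣ suc x - x ∣ ≟ 1
... | yes _ = refl
... | no ≢1 = contradiction (trans (m≤n⇒∣n-m∣≡n∸m (n≤1+n x)) (m+n∸n≡m 1 x)) ≢1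

adjBreaks-++-∷ : ∀ xs x ys → adjBreaks (xs ++ x ∷ ys) ≡ adjBreaks (xs ∷ʳ x) + adjBreaks (x ∷ ys)
adjBreaks-++-∷ []           x ys = refl
adjBreaks-++-∷ (y ∷ [])     x ys = cong (_+ adjBreaks (x ∷ ys)) (sym (+-identityʳ (isBreak y x)))
adjBreaks-++-∷ (y ∷ z ∷ zs) x ys =
  trans (cong (isBreak y z +_) (adjBreaks-++-∷ (z ∷ zs) x ys)) (sym (+-assoc (isBreak y z) _ _))

adjBreaks≤adjBreaks-∷ʳ : ∀ xs x → adjBreaks xs ≤ adjBreaks (xs ∷ʳ x)
adjBreaks≤adjBreaks-∷ʳ []           x = z≤n
adjBreaks≤adjBreaks-∷ʳ (y ∷ [])     x = z≤n
adjBreaks≤adjBreaks-∷ʳ (y ∷ z ∷ zs) x = +-monoʳ-≤ (isBreak y z) (adjBreaks≤adjBreaks-∷ʳ (z ∷ zs) x)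

adjBreaks-∷ʳ≤ : ∀ xs x → adjBreaks (xs ∷ʳ x) ≤ suc (adjBreaks xs)
adjBreaks-∷ʳ≤ []           x = z≤n
adjBreaks-∷ʳ≤ (y ∷ [])     x = ≤-trans (≤-reflexive (+-identityʳ _)) (isBreak≤1 y x)
adjBreaks-∷ʳ≤ (y ∷ z ∷ zs) x = ≤-trans (+-monoʳ-≤ (isBreak y z) (adjBreaks-∷ʳ≤ (z ∷ zs) x))
                                       (≤-reflexive (+-suc (isBreak y z) _))

adjBreaks-++-≥ : ∀ xs ys → adjBreaks xs + adjBreaks ys ≤ adjBreaks (xs ++ ys)
adjBreaks-++-≥ xs []       = ≤-reflexive (trans (+-identityʳ _) (cong adjBreaks (sym (++-identityʳ xs))))
adjBreaks-++-≥ xs (y ∷ ys) = ≤-trans (+-monoˡ-≤ (adjBreaks (y ∷ ys)) (adjBreaks≤adjBreaks-∷ʳ xs y))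
                                     (≤-reflexive (sym (adjBreaks-++-∷ xs y ys)))

adjBreaks-++-≤ : ∀ xs ys → adjBreaks (xs ++ ys) ≤ suc (adjBreaks xs + adjBreaks ys)
adjBreaks-++-≤ xs []       = ≤-trans (≤-reflexive (cong adjBreaks (++-identityʳ xs)))
                                     (≤-trans (m≤m+n _ 0) (n≤1+n _))
adjBreaks-++-≤ xs (y ∷ ys) = ≤-trans (≤-reflexive (adjBreaks-++-∷ xs y ys))
                                     (+-monoˡ-≤ (adjBreaks (y ∷ ys)) (adjBreaks-∷ʳ≤ xs y))

adjBreaks-reverse : ∀ xs → adjBreaks (reverse xs) ≡ adjBreaks xs
adjBreaks-reverse []           = refl
adjBreaks-reverse (x ∷ [])     = refl
adjBreaks-reverse (x ∷ y ∷ ys) = begin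
  adjBreaks (reverse (x ∷ y ∷ ys))                 ≡⟨ cong adjBreaks (unfold-reverse x (y ∷ ys)) ⟩
  adjBreaks (reverse (y ∷ ys) ∷ʳ x)                ≡⟨ cong (λ l → adjBreaks (l ∷ʳ x)) (unfold-reverse y ys) ⟩
  adjBreaks (reverse ys ∷ʳ y ∷ʳ x)                 ≡⟨ cong adjBreaks (++-assoc (reverse ys) [ y ] [ x ]) ⟩
  adjBreaks (reverse ys ++ y ∷ [ x ])              ≡⟨ adjBreaks-++-∷ (reverse ys) y [ x ] ⟩
  adjBreaks (reverse ys ∷ʳ y) + (isBreak y x + 0)  ≡⟨ cong (adjBreaks (reverse ys ∷ʳ y) +_) (+-identityʳ _) ⟩
  adjBreaks (reverse ys ∷ʳ y) + isBreak y x        ≡⟨ cong (λ l → adjBreaks l + isBreak y x) (unfold-reverse y ys) ⟨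
  adjBreaks (reverse (y ∷ ys)) + isBreak y x       ≡⟨ cong (_+ isBreak y x) (adjBreaks-reverse (y ∷ ys)) ⟩
  adjBreaks (y ∷ ys) + isBreak y x                 ≡⟨ cong (adjBreaks (y ∷ ys) +_) (isBreak-sym y x) ⟩
  adjBreaks (y ∷ ys) + isBreak x y                 ≡⟨ +-comm _ (isBreak x y) ⟩
  adjBreaks (x ∷ y ∷ ys)                           ∎
  where open ≡-Reasoning

adjBreaks-swap : ∀ A A′ B C → adjBreaks A′ ≡ adjBreaks A →
                 adjBreaks (A ++ B ++ C) ≤ 2 + adjBreaks (B ++ A′ ++ C)
adjBreaks-swap A A′ B C a′≡a = begin
  adjBreaks (A ++ B ++ C)                    ≤⟨ adjBreaks-++-≤ A (B ++ C) ⟩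
  suc (a + adjBreaks (B ++ C))               ≤⟨ s≤s (+-monoʳ-≤ a (adjBreaks-++-≤ B C)) ⟩
  suc (a + suc (b + c))                      ≡⟨ cong suc (+-suc a (b + c)) ⟩
  2 + (a + (b + c))                          ≡⟨ cong (2 +_) (x∙yz≈y∙xz a b c) ⟩
  2 + (b + (a + c))                          ≡⟨ cong (λ t → 2 + (b + (t + c))) a′≡a ⟨
  2 + (b + (adjBreaks A′ + c))               ≤⟨ +-monoʳ-≤ 2 (+-monoʳ-≤ b (adjBreaks-++-≥ A′ C)) ⟩
  2 + (b + adjBreaks (A′ ++ C))              ≤⟨ +-monoʳ-≤ 2 (adjBreaks-++-≥ B (A′ ++ C)) ⟩
  2 + adjBreaks (B ++ A′ ++ C)               ∎
  where
    open ≤-Reasoning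
    a = adjBreaks A
    b = adjBreaks B
    c = adjBreaks C

-- A′ is A itself or its reversal.
data PrefixBlockMove : List ℕ → List ℕ → Set where
  move : ∀ A A′ B D → length A′ ≡ length A → adjBreaks A′ ≡ adjBreaks A →
         PrefixBlockMove (A ++ B ++ D) (B ++ A′ ++ D)

take++take-drop++drop≡id : ∀ {i k} (xs : List ℕ) → i ≤ k →
                           take i xs ++ take (k ∸ i) (drop i xs) ++ drop k xs ≡ xs
take++take-drop++drop≡id {i} {k} xs i≤k = begin
  take i xs ++ take (k ∸ i) (drop i xs) ++ drop k xs
    ≡⟨ cong (λ t → take i xs ++ take (k ∸ i) (drop i xs) ++ drop t xs) (m+[n∸m]≡n i≤k) ⟨
  take i xs ++ take (k ∸ i) (drop i xs) ++ drop (i + (k ∸ i)) xs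
    ≡⟨ cong (λ l → take i xs ++ take (k ∸ i) (drop i xs) ++ l) (drop-drop i (k ∸ i) xs) ⟨
  take i xs ++ take (k ∸ i) (drop i xs) ++ drop (k ∸ i) (drop i xs)
    ≡⟨ cong (take i xs ++_) (take++drop≡id (k ∸ i) (drop i xs)) ⟩
  take i xs ++ drop i xs
    ≡⟨ take++drop≡id i xs ⟩
  xs ∎
  where open ≡-Reasoning

prefixBlockMove : ∀ i k xs A′ → i ≤ k →
                  length A′ ≡ length (take i xs) → adjBreaks A′ ≡ adjBreaks (take i xs) →
                  PrefixBlockMove xs (take (k ∸ i) (drop i xs) ++ A′ ++ drop k xs)
prefixBlockMove i k xs A′ i≤k ℓ≡ b≡ =
  subst (λ l → PrefixBlockMove l (B ++ A′ ++ D)) (take++take-drop++drop≡id xs i≤k)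
        (move (take i xs) A′ B D ℓ≡ b≡)
  where
    B = take (k ∸ i) (drop i xs)
    D = drop k xs

step⇒prefixBlockMove : ∀ {xs ys} → Step xs ys → PrefixBlockMove xs ys
step⇒prefixBlockMove {xs} (prefixReversal j _ _) =
  subst (λ l → PrefixBlockMove l (reverse A ++ D)) (take++drop≡id (j ∸ 1) xs)
        (move A (reverse A) [] D (length-reverse A) (adjBreaks-reverse A))
  where
    A = take (j ∸ 1) xs
    D = drop (j ∸ 1) xs
step⇒prefixBlockMove {xs} (prefixTransposition (suc i) (suc k) _ _ (s≤s i<k) _) =
  prefixBlockMove i k xs (take i xs) (<⇒≤ i<k) refl refl
step⇒prefixBlockMove {xs} (prefixTransreversal (suc i) (suc k) _ _ (s≤s i<k) _) =
  prefixBlockMove i k xs (reverse (take i xs)) (<⇒≤ i<k) (length-reverse (take i xs)) (adjBreaks-reverse (take i xs))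

prefixBlockMove-length : ∀ {xs ys} → PrefixBlockMove xs ys → length ys ≡ length xs
prefixBlockMove-length (move A A′ B D ℓ≡ _) = begin
  length (B ++ A′ ++ D)                    ≡⟨ length-++ B ⟩
  length B + length (A′ ++ D)              ≡⟨ cong (length B +_) (length-++ A′) ⟩
  length B + (length A′ + length D)        ≡⟨ cong (λ t → length B + (t + length D)) ℓ≡ ⟩
  length B + (length A + length D)         ≡⟨ x∙yz≈y∙xz (length B) (length A) (length D) ⟩
  length A + (length B + length D)         ≡⟨ cong (length A +_) (length-++ B) ⟨
  length A + length (B ++ D)               ≡⟨ length-++ A ⟨
  length (A ++ B ++ D)                     ∎
  where open ≡-Reasoning

prefixBlockMove-adjBreaks-∷ʳ : ∀ {xs ys} → PrefixBlockMove xs ys →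
                               ∀ s → adjBreaks (xs ∷ʳ s) ≤ 2 + adjBreaks (ys ∷ʳ s)
prefixBlockMove-adjBreaks-∷ʳ (move A A′ B D _ b≡) s
  rewrite ++-assoc A (B ++ D) [ s ] | ++-assoc B D [ s ]
        | ++-assoc B (A′ ++ D) [ s ] | ++-assoc A′ D [ s ]
  = adjBreaks-swap A A′ B (D ∷ʳ s) b≡

-- breakpoints xs ≡ suc (sentinelBreaks xs): position 1 is not counted here.
sentinelBreaks : List ℕ → ℕ
sentinelBreaks xs = adjBreaks (xs ∷ʳ suc (length xs))

step-sentinelBreaks : ∀ {xs ys} → Step xs ys → sentinelBreaks xs ≤ 2 + sentinelBreaks ys
step-sentinelBreaks {xs} {ys} st = begin
  adjBreaks (xs ∷ʳ suc (length xs))        ≤⟨ prefixBlockMove-adjBreaks-∷ʳ blockMove (suc (length xs)) ⟩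
  2 + adjBreaks (ys ∷ʳ suc (length xs))    ≡⟨ cong (λ n → 2 + adjBreaks (ys ∷ʳ suc n)) (prefixBlockMove-length blockMove) ⟨
  2 + sentinelBreaks ys                    ∎
  where
    open ≤-Reasoning
    blockMove : PrefixBlockMove xs ys
    blockMove = step⇒prefixBlockMove st

steps-sentinelBreaks : ∀ {xs m zs} → Steps xs m zs → sentinelBreaks xs ≤ m + m + sentinelBreaks zs
steps-sentinelBreaks done = ≤-refl
steps-sentinelBreaks {xs} {suc m} {zs} (step {ys = ys} st sts) = begin
  sentinelBreaks xs                        ≤⟨ step-sentinelBreaks st ⟩
  2 + sentinelBreaks ys                    ≤⟨ +-monoʳ-≤ 2 (steps-sentinelBreaks sts) ⟩
  2 + (m + m + sentinelBreaks zs)          ≡⟨ cong (λ t → suc t + sentinelBreaks zs) (+-suc m m) ⟨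
  suc m + suc m + sentinelBreaks zs        ∎
  where open ≤-Reasoning

adjBreaks-applyUpTo-consecutive : ∀ (f : ℕ → ℕ) → (∀ i → f (suc i) ≡ suc (f i)) →
                                  ∀ n → adjBreaks (applyUpTo f n) ≡ 0
adjBreaks-applyUpTo-consecutive f f-suc zero          = refl
adjBreaks-applyUpTo-consecutive f f-suc (suc zero)    = refl
adjBreaks-applyUpTo-consecutive f f-suc (suc (suc n)) =
  cong₂ _+_ (subst (λ y → isBreak (f 0) y ≡ 0) (sym (f-suc 0)) (isBreak-suc (f 0)))
            (adjBreaks-applyUpTo-consecutive (f ∘ suc) (f-suc ∘ suc) (suc n))

sentinelBreaks-identity : ∀ n → sentinelBreaks (identity n) ≡ 0
sentinelBreaks-identity n = begin
  adjBreaks (identity n ∷ʳ suc (length (identity n)))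
    ≡⟨ cong (λ ℓ → adjBreaks (identity n ∷ʳ suc ℓ)) (trans (length-map suc (upTo n)) (length-upTo n)) ⟩
  adjBreaks (identity n ∷ʳ suc n)
    ≡⟨ cong (λ l → adjBreaks (l ∷ʳ suc n)) (map-upTo suc n) ⟩
  adjBreaks (applyUpTo suc n ∷ʳ suc n)
    ≡⟨ cong adjBreaks (applyUpTo-∷ʳ suc n) ⟩
  adjBreaks (applyUpTo suc (suc n))
    ≡⟨ adjBreaks-applyUpTo-consecutive suc (λ _ → refl) (suc n) ⟩
  0 ∎
  where open ≡-Reasoning

theorem3 : (n : ℕ) (π : List ℕ) → π ↭ identity n →
    (m : ℕ) → Steps π m (identity n) → ⌊ breakpoints π /2⌋ ≤ m
theorem3 n π _ m sorting = begin
  ⌈ sentinelBreaks π /2⌉   ≤⟨ ⌈n/2⌉-mono sentinelBreaks≤2m ⟩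
  ⌈ m + m /2⌉              ≡⟨ n≡⌈n+n/2⌉ m ⟨
  m                        ∎
  where
    open ≤-Reasoning
    sentinelBreaks≤2m : sentinelBreaks π ≤ m + m
    sentinelBreaks≤2m = ≤-trans (steps-sentinelBreaks sorting)
      (≤-reflexive (trans (cong (m + m +_) (sentinelBreaks-identity n)) (+-identityʳ _)))
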